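{- Let $m\ge2$, $p$ a prime number and $k\in\{0,1,\dots,p-1\}$. For $b\in\mathbb{Z}/p^m\mathbb{Z}$ write $R_2^{b}=\{(a_1,a_2)\in(\mathbb{Z}/p^m\mathbb{Z})^2 : a_1a_2-\overline{1}=b\}$. (i) If $p$ is odd, then $w_4^{ -\overline{1}}(\mathbb{Z}/p^m\mathbb{Z})=|R_2^{\overline{1+kp^{m-1}}}|=p^{m-1}(p-1)$. (ii) $\sum_{j=0}^{p-1}|R_2^{\overline{ -1-jp^{m-1}}}|=p^m(m(p-1)+1)$, and $w_4^{\overline{1}}(\mathbb{Z}/p^m\mathbb{Z})=|R_2^{\overline{ -1}}|=p^{m-1}(p(m+1)-m)$. (iii) If $p=2$ and $m\ge3$, then $w_4^{ -\overline{1}}(\mathbb{Z}/2^m\mathbb{Z})=|R_2^{\overline{1}}|=|R_2^{\overline{1+2^{m-1}}}|=2^m$.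
   Context: For a commutative unitary ring $A$ and $(a_1,\dots,a_n)\in A^n$, $M_{n}(a_1,\ldots,a_n):=\begin{pmatrix} a_{n} & -1_{A} \\ 1_{A} & 0_{A}\end{pmatrix}\cdots\begin{pmatrix} a_{1} & -1_{A} \\ 1_{A} & 0_{A}\end{pmatrix}$. For a unit $u$ of $A$, $w_{n}^{u}(A)$ is the number of $(a_1,\dots,a_n)\in A^n$ with $M_n(a_1,\dots,a_n)=\begin{pmatrix} u & 0_A\\ 0_A & u^{ -1}\end{pmatrix}$. $\overline{a}$ denotes the class of an integer $a$ modulo $p^m$. -}

module Defs where

open import Data.Nat using (ℕ; zero; suc)
open import Data.Nat.Divisibility using (_∣_; _∣?_)
open import Data.Integer as ℤ using (ℤ; +_; ∣_∣)
open import Data.Fin using (Fin; toℕ)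
open import Data.Fin.Base using () renaming (toℕ to toℕᶠ)
open import Data.Vec using (Vec; []; _∷_)
open import Data.List using (List; []; _∷_; length; filter; map; concatMap; allFin)
open import Data.Product using (_×_; _,_)
open import Relation.Nullary using (Dec)
open import Relation.Nullary.Decidable using (_×-dec_)

_≡[_]_ : ℤ → ℕ → ℤ → Set
x ≡[ N ] y = N ∣ ∣ x ℤ.- y ∣

_≡[_]?_ : (x : ℤ) (N : ℕ) (y : ℤ) → Dec (x ≡[ N ] y)
x ≡[ N ]? y = N ∣? ∣ x ℤ.- y ∣

-- 2x2 integer matrices (entries are representatives of classes mod N)
record Mat : Set where
  constructor mat
  field
    m11 m12 m21 m22 : ℤ

_⊗_ : Mat → Mat → Mat
mat a b c d ⊗ mat e f g h =
  mat (a ℤ.* e ℤ.+ b ℤ.* g) (a ℤ.* f ℤ.+ b ℤ.* h)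
      (c ℤ.* e ℤ.+ d ℤ.* g) (c ℤ.* f ℤ.+ d ℤ.* h)

E : ℤ → Mat
E a = mat a (ℤ.- (+ 1)) (+ 1) (+ 0)

idM : Mat
idM = mat (+ 1) (+ 0) (+ 0) (+ 1)

-- M_n(a_1,...,a_n) = E(a_n) ⋯ E(a_1); the vector is a_1 ∷ … ∷ a_n ∷ []
Mn : ∀ {n} → Vec ℤ n → Mat
Mn [] = idM
Mn (a ∷ as) = Mn as ⊗ E a

_≡M[_]_ : Mat → ℕ → Mat → Set
mat a b c d ≡M[ N ] mat e f g h =
  (a ≡[ N ] e) × (b ≡[ N ] f) × (c ≡[ N ] g) × (d ≡[ N ] h)

_≡M[_]?_ : (X : Mat) (N : ℕ) (Y : Mat) → Dec (X ≡M[ N ] Y)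
mat a b c d ≡M[ N ]? mat e f g h =
  (a ≡[ N ]? e) ×-dec ((b ≡[ N ]? f) ×-dec ((c ≡[ N ]? g) ×-dec (d ≡[ N ]? h)))

-- elements of ℤ/Nℤ are represented by Fin N (canonical representatives 0..N-1)
rep : ∀ {N} → Fin N → ℤ
rep x = + toℕ x

allVec : (n N : ℕ) → List (Vec (Fin N) n)
allVec zero N = [] ∷ []
allVec (suc n) N = concatMap (λ x → map (x ∷_) (allVec n N)) (allFin N)

repVec : ∀ {n N} → Vec (Fin N) n → Vec ℤ n
repVec [] = []
repVec (x ∷ xs) = rep x ∷ repVec xs

-- w_n^u(ℤ/Nℤ): number of (a_1..a_n) ∈ (ℤ/Nℤ)^n with M_n(a) = diag(u, u⁻¹),
-- where u and uinv are integer representatives of the unit u and its inverse.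
w : (n N : ℕ) (u uinv : ℤ) → ℕ
w n N u uinv =
  length (filter (λ v → Mn (repVec v) ≡M[ N ]? mat u (+ 0) (+ 0) uinv) (allVec n N))

R2 : (N : ℕ) (b : ℤ) → ℕ
R2 N b =
  length (filter (λ v → pr v) (allVec 2 N))
  where
  P : Vec (Fin N) 2 → Set
  P (a₁ ∷ a₂ ∷ []) = (rep a₁ ℤ.* rep a₂ ℤ.- + 1) ≡[ N ] b
  pr : (v : Vec (Fin N) 2) → Dec (P v)
  pr (a₁ ∷ a₂ ∷ []) = (rep a₁ ℤ.* rep a₂ ℤ.- + 1) ≡[ N ]? b

-- For u² = 1, M₄(a₁,…,a₄) ≡ diag(u,u) (mod N) is equivalent to a₁a₂ ≡ 1 − u, a₃ ≡ −u a₁,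
-- a₄ ≡ −u a₂; hence w₄ᵘ = |R₂^{−u}|, and |R₂ᵇ| = T(N, b + 1), the number of pairs (a, c)
-- with a c ≡ b + 1.  Modulo p^{m+1}, sort a by its residue mod p: if a is a unit there is
-- exactly one c; if a = p a′ there is none unless p ∣ t, and for t = p t′ there are p times
-- as many as solutions of a′c ≡ t′ mod p^m.  So T(p^{m+1}, t) = p^m (p − 1) when p ∤ t and
-- T(p^{m+1}, p t′) = p T(p^m, t′) + p^m (p − 1), which also gives a closed form for T(p^m, 0).
-- Finally the classes −j p^{m−1} (j < p) are the lifts of 0 mod p^{m−1}, so the sum of T
-- over them is p² T(p^{m−1}, 0).
module Submission where

open import Defs
open import Data.Nat using (ℕ; _+_; _*_; _∸_; _^_; _≤_; _<_)
open import Data.Nat.Primality using (Prime)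
open import Data.Integer as ℤ using (ℤ; +_)
open import Data.List using (map; upTo)
open import Data.Nat.ListAction using (sum)
open import Data.Product using (_×_)
open import Relation.Binary.PropositionalEquality using (_≡_; _≢_)

open import Data.Empty using (⊥-elim)
open import Data.Fin using (Fin; toℕ)
open import Data.Integer using () renaming (_+_ to _+ᶻ_; _*_ to _*ᶻ_; _-_ to _-ᶻ_; -_ to -ᶻ_)
open import Data.Integer.DivMod using (_%ℕ_; _/ℕ_; a≡a%ℕn+[a/ℕn]*n; n%ℕd<d)
open import Data.Integer.Divisibility.Signed
  using (_∣_; divides; ∣ᵤ⇒∣; ∣⇒∣ᵤ; ∣-refl; ∣-trans; ∣m∣n⇒∣m+n; ∣m⇒∣-m; ∣n⇒∣m*n)
import Data.Integer.Properties as ℤ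
open import Data.Integer.Tactic.RingSolver using (solve; solve-∀)
open import Data.List as List using (List; _++_; length; filter; concatMap; applyUpTo; tabulate; allFin)
open import Data.List.Properties using (map-cong; map-++; map-∘; map-tabulate)
open import Data.Nat using (zero; suc; z≤n; s≤s; z<s; s<s; NonZero)
open import Data.Nat.Coprimality using (Coprime; coprime-Bézout; coprime-divisor)
import Data.Nat.Divisibility as ℕ
open import Data.Nat.GCD using (module Bézout)
open import Data.Nat.ListAction.Properties using (sum-++)
open import Data.Nat.Primality using (prime⇒irreducible; prime⇒nonZero; prime[2]; ¬prime[1])
open import Data.Nat.Properties
import Data.Nat.Tactic.RingSolver as ℕ-Solver
open import Data.Product using (_,_; ∃)
open import Data.Sum using (inj₁; inj₂)
open import Data.Vec as Vec using (Vec; []; _∷_)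
open import Function using (_∘_; id; case_of_)
open import Relation.Binary.PropositionalEquality
  using (refl; sym; trans; cong; cong₂; subst; module ≡-Reasoning)
open import Relation.Nullary using (Dec; yes; no; ¬_)
open import Relation.Nullary.Decidable using (_×-dec_)
open import Relation.Unary using (Pred; Decidable)

-- Sums over initial segments of ℕ

∑< : ℕ → (ℕ → ℕ) → ℕ
∑< zero    f = 0
∑< (suc n) f = f 0 + ∑< n (f ∘ suc)

syntax ∑< n (λ x → e) = ∑[ x < n ] e

∑-cong : ∀ n {f g : ℕ → ℕ} → (∀ x → f x ≡ g x) → ∑< n f ≡ ∑< n g
∑-cong zero    eq = refl
∑-cong (suc n) eq = cong₂ _+_ (eq 0) (∑-cong n (eq ∘ suc))

∑-cong< : ∀ n {f g : ℕ → ℕ} → (∀ x → x < n → f x ≡ g x) → ∑< n f ≡ ∑< n g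
∑-cong< zero    eq = refl
∑-cong< (suc n) eq = cong₂ _+_ (eq 0 z<s) (∑-cong< n (λ x x<n → eq (suc x) (s<s x<n)))

∑-const : ∀ n c → ∑[ _ < n ] c ≡ n * c
∑-const zero    c = refl
∑-const (suc n) c = cong (_+_ c) (∑-const n c)

∑-zero : ∀ n → ∑[ _ < n ] 0 ≡ 0
∑-zero n = trans (∑-const n 0) (*-zeroʳ n)

∑-++ : ∀ m n f → ∑< (m + n) f ≡ ∑< m f + ∑[ x < n ] f (m + x)
∑-++ zero    n f = refl
∑-++ (suc m) n f = trans (cong (_+_ (f 0)) (∑-++ m n (f ∘ suc))) (sym (+-assoc (f 0) _ _))

∑-distrib-+ : ∀ n f g → ∑[ x < n ] (f x + g x) ≡ ∑< n f + ∑< n g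
∑-distrib-+ zero    f g = refl
∑-distrib-+ (suc n) f g =
  trans (cong (_+_ (f 0 + g 0)) (∑-distrib-+ n (f ∘ suc) (g ∘ suc))) (interchange (f 0) (g 0) _ _)
  where
  interchange : ∀ a b c d → a + b + (c + d) ≡ a + c + (b + d)
  interchange = ℕ-Solver.solve-∀

∑-distribˡ-* : ∀ n c f → ∑[ x < n ] (c * f x) ≡ c * ∑< n f
∑-distribˡ-* zero    c f = sym (*-zeroʳ c)
∑-distribˡ-* (suc n) c f =
  trans (cong (_+_ (c * f 0)) (∑-distribˡ-* n c (f ∘ suc))) (sym (*-distribˡ-+ c (f 0) _))

∑-swap : ∀ m n (F : ℕ → ℕ → ℕ) → ∑[ i < m ] ∑[ j < n ] F i j ≡ ∑[ j < n ] ∑[ i < m ] F i j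
∑-swap zero    n F = sym (∑-zero n)
∑-swap (suc m) n F = trans (cong (_+_ (∑< n (F 0))) (∑-swap m n (F ∘ suc)))
                           (sym (∑-distrib-+ n (F 0) (λ j → ∑[ i < m ] F (suc i) j)))

∑-periodic : ∀ q N f → (∀ x → f (N + x) ≡ f x) → ∑< (q * N) f ≡ q * ∑< N f
∑-periodic zero    N f per = refl
∑-periodic (suc q) N f per = trans (∑-++ N (q * N) f)
  (cong (_+_ (∑< N f)) (trans (∑-cong (q * N) per) (∑-periodic q N f per)))

∑-residues : ∀ M p F → ∑< (M * p) F ≡ ∑[ i < M ] ∑[ r < p ] F (i * p + r)
∑-residues zero    p F = refl
∑-residues (suc M) p F = trans (∑-++ p (M * p) F)
  (cong (_+_ (∑< p F)) (trans (∑-residues M p (λ x → F (p + x)))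
    (∑-cong M (λ i → ∑-cong p (λ r → cong F (sym (+-assoc p (i * p) r)))))))

𝟙 : ∀ {ℓ} {P : Set ℓ} → Dec P → ℕ
𝟙 (yes _) = 1
𝟙 (no _)  = 0

𝟙-cong : ∀ {ℓ ℓ′} {P : Set ℓ} {Q : Set ℓ′} → (P → Q) → (Q → P) → (p : Dec P) (q : Dec Q) →
         𝟙 p ≡ 𝟙 q
𝟙-cong P⇒Q Q⇒P (yes p) (yes q) = refl
𝟙-cong P⇒Q Q⇒P (yes p) (no ¬q) = ⊥-elim (¬q (P⇒Q p))
𝟙-cong P⇒Q Q⇒P (no ¬p) (yes q) = ⊥-elim (¬p (Q⇒P q))
𝟙-cong P⇒Q Q⇒P (no ¬p) (no ¬q) = refl

𝟙-reject : ∀ {ℓ} {P : Set ℓ} → ¬ P → (p : Dec P) → 𝟙 p ≡ 0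
𝟙-reject ¬p (yes p) = ⊥-elim (¬p p)
𝟙-reject ¬p (no _)  = refl

𝟙-× : ∀ {ℓ ℓ′} {P : Set ℓ} {Q : Set ℓ′} (p : Dec P) (q : Dec Q) → 𝟙 (p ×-dec q) ≡ 𝟙 p * 𝟙 q
𝟙-× (yes _) (yes _) = refl
𝟙-× (yes _) (no _)  = refl
𝟙-× (no _)  (yes _) = refl
𝟙-× (no _)  (no _)  = refl

∑-𝟙-≟ : ∀ N r → r < N → ∑[ c < N ] 𝟙 (c ≟ r) ≡ 1
∑-𝟙-≟ (suc N) zero    _         =
  cong suc (trans (∑-cong N (λ c → 𝟙-reject (λ ()) (suc c ≟ 0))) (∑-zero N))
∑-𝟙-≟ (suc N) (suc r) (s<s r<N) =
  trans (∑-cong N (λ c → 𝟙-cong suc-injective (cong suc) (suc c ≟ suc r) (c ≟ r))) (∑-𝟙-≟ N r r<N)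

length-filter : ∀ {A : Set} {ℓ} {P : Pred A ℓ} (P? : Decidable P) xs →
  length (filter P? xs) ≡ sum (map (𝟙 ∘ P?) xs)
length-filter P? List.[] = refl
length-filter P? (x List.∷ xs) with P? x
... | yes _ = cong suc (length-filter P? xs)
... | no _  = length-filter P? xs

sum-map-applyUpTo : ∀ n (f g : ℕ → ℕ) → sum (map f (applyUpTo g n)) ≡ ∑[ x < n ] f (g x)
sum-map-applyUpTo zero    f g = refl
sum-map-applyUpTo (suc n) f g = cong (_+_ (f (g 0))) (sum-map-applyUpTo n f (g ∘ suc))

sum-map-concatMap : ∀ {A B : Set} (h : B → ℕ) (f : A → List B) xs →
  sum (map h (concatMap f xs)) ≡ sum (map (λ x → sum (map h (f x))) xs)
sum-map-concatMap h f List.[]         = refl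
sum-map-concatMap h f (x List.∷ xs) = begin
  sum (map h (f x ++ concatMap f xs))
    ≡⟨ cong sum (map-++ h (f x) _) ⟩
  sum (map h (f x) ++ map h (concatMap f xs))
    ≡⟨ sum-++ (map h (f x)) _ ⟩
  sum (map h (f x)) + sum (map h (concatMap f xs))
    ≡⟨ cong (_+_ (sum (map h (f x)))) (sum-map-concatMap h f xs) ⟩
  sum (map h (f x)) + sum (map (λ x → sum (map h (f x))) xs) ∎
  where open ≡-Reasoning

sum-map-allFin : ∀ N (g : ℕ → ℕ) → sum (map (g ∘ toℕ) (allFin N)) ≡ ∑< N g
sum-map-allFin N g = trans (cong sum (map-tabulate {n = N} id (g ∘ toℕ))) (sum-tabulate N g)
  where
  sum-tabulate : ∀ N (g : ℕ → ℕ) → sum (tabulate {n = N} (g ∘ toℕ)) ≡ ∑< N g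
  sum-tabulate zero    g = refl
  sum-tabulate (suc N) g = cong (_+_ (g 0)) (sum-tabulate N (g ∘ suc))

∑ᵛ : ∀ n → ℕ → (Vec ℕ n → ℕ) → ℕ
∑ᵛ zero    N g = g []
∑ᵛ (suc n) N g = ∑[ a < N ] ∑ᵛ n N (λ as → g (a ∷ as))

sum-map-allVec : ∀ n N (g : Vec ℕ n → ℕ) → sum (map (g ∘ Vec.map toℕ) (allVec n N)) ≡ ∑ᵛ n N g
sum-map-allVec zero    N g = +-identityʳ (g [])
sum-map-allVec (suc n) N g = begin
  sum (map h (concatMap (λ x → map (x ∷_) (allVec n N)) (allFin N)))
    ≡⟨ sum-map-concatMap h _ (allFin N) ⟩
  sum (map (λ x → sum (map h (map (x ∷_) (allVec n N)))) (allFin N))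
    ≡⟨ cong sum (map-cong (λ x → cong sum (sym (map-∘ (allVec n N)))) (allFin N)) ⟩
  sum (map (λ x → sum (map (h ∘ (x ∷_)) (allVec n N))) (allFin N))
    ≡⟨ cong sum (map-cong (λ x → sum-map-allVec n N (λ as → g (toℕ x ∷ as))) (allFin N)) ⟩
  sum (map (λ x → ∑ᵛ n N (λ as → g (toℕ x ∷ as))) (allFin N))
    ≡⟨ sum-map-allFin N _ ⟩
  ∑ᵛ (suc n) N g ∎
  where
  open ≡-Reasoning
  h : Vec (Fin N) (suc n) → ℕ
  h = g ∘ Vec.map toℕ

count-allVec : ∀ {ℓ} n N {P : Pred (Vec (Fin N) n) ℓ} (P? : Decidable P) (g : Vec ℕ n → ℕ) →
  (∀ v → 𝟙 (P? v) ≡ g (Vec.map toℕ v)) → length (filter P? (allVec n N)) ≡ ∑ᵛ n N g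
count-allVec n N P? g eq = begin
  length (filter P? (allVec n N))          ≡⟨ length-filter P? (allVec n N) ⟩
  sum (map (𝟙 ∘ P?) (allVec n N))          ≡⟨ cong sum (map-cong eq (allVec n N)) ⟩
  sum (map (g ∘ Vec.map toℕ) (allVec n N)) ≡⟨ sum-map-allVec n N g ⟩
  ∑ᵛ n N g                                 ∎
  where open ≡-Reasoning

-- Congruences modulo N

-- x ≡[ N ] y unfolds to N ∣ ∣x − y∣, from which unification cannot recover x and y;
-- so the compared integers are passed explicitly throughout.
∣⇒≡[] : ∀ {N} x y {z} → + N ∣ z → x -ᶻ y ≡ z → x ≡[ N ] y
∣⇒≡[] x y N∣z refl = ∣⇒∣ᵤ N∣z

≡[]⇒∣ : ∀ {N} x y → x ≡[ N ] y → + N ∣ x -ᶻ y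
≡[]⇒∣ x y = ∣ᵤ⇒∣

∣-≡ : ∀ {k z w} → k ∣ z → z ≡ w → k ∣ w
∣-≡ k∣z refl = k∣z

infixl 4 _∣+_
infixr 5 _∣*_

_∣+_ : ∀ {k m n} → k ∣ m → k ∣ n → k ∣ m +ᶻ n
_∣+_ = ∣m∣n⇒∣m+n

_∣*_ : ∀ {k} c {n} → k ∣ n → k ∣ c *ᶻ n
_∣*_ = ∣n⇒∣m*n

≡[]-sym : ∀ {N} x y → x ≡[ N ] y → y ≡[ N ] x
≡[]-sym x y x≡y = ∣⇒≡[] y x (∣m⇒∣-m (≡[]⇒∣ x y x≡y)) (solve (x List.∷ y List.∷ List.[]))

≡[]-trans : ∀ {N} x y z → x ≡[ N ] y → y ≡[ N ] z → x ≡[ N ] z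
≡[]-trans x y z x≡y y≡z =
  ∣⇒≡[] x z (≡[]⇒∣ x y x≡y ∣+ ≡[]⇒∣ y z y≡z) (solve (x List.∷ y List.∷ z List.∷ List.[]))

≡[]-by : ∀ {N} x y k → x ≡ y +ᶻ k *ᶻ + N → x ≡[ N ] y
≡[]-by {N} _ y k refl = ∣⇒≡[] (y +ᶻ k *ᶻ + N) y (k ∣* ∣-refl) (cancel y k (+ N))
  where
  cancel : ∀ y k n → y +ᶻ k *ᶻ n -ᶻ y ≡ k *ᶻ n
  cancel = solve-∀

𝟙-≡[]-respˡ : ∀ {N} x x′ y → x ≡[ N ] x′ → 𝟙 (x ≡[ N ]? y) ≡ 𝟙 (x′ ≡[ N ]? y)
𝟙-≡[]-respˡ {N} x x′ y x≡x′ =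
  𝟙-cong (≡[]-trans x′ x y (≡[]-sym x x′ x≡x′)) (≡[]-trans x x′ y x≡x′) (x ≡[ N ]? y) (x′ ≡[ N ]? y)

<∧∣⇒≡0 : ∀ {N d} → d < N → N ℕ.∣ d → d ≡ 0
<∧∣⇒≡0 {d = zero}  _   _   = refl
<∧∣⇒≡0 {d = suc d} d<N N∣d = ⊥-elim (ℕ.>⇒∤ d<N N∣d)

≡[]-canonical-≤ : ∀ {N c r} → c ≤ r → r < N → (+ c) ≡[ N ] (+ r) → c ≡ r
≡[]-canonical-≤ {N} {c} {r} c≤r r<N c≡r =
  ≤-antisym c≤r (m∸n≡0⇒m≤n (<∧∣⇒≡0 (≤-<-trans (m∸n≤m r c) r<N) (subst (N ℕ.∣_) ∣c-r∣≡r∸c c≡r)))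
  where
  ∣c-r∣≡r∸c : ℤ.∣ + c -ᶻ + r ∣ ≡ r ∸ c
  ∣c-r∣≡r∸c = trans (cong ℤ.∣_∣ (ℤ.m-n≡m⊖n c r)) (ℤ.∣⊖∣-≤ c≤r)

≡[]-canonical : ∀ {N c r} → c < N → r < N → (+ c) ≡[ N ] (+ r) → c ≡ r
≡[]-canonical {c = c} {r} c<N r<N c≡r with ≤-total c r
... | inj₁ c≤r = ≡[]-canonical-≤ c≤r r<N c≡r
... | inj₂ r≤c = sym (≡[]-canonical-≤ r≤c c<N (≡[]-sym (+ c) (+ r) c≡r))

≡[]-%ℕ : ∀ N .{{_ : NonZero N}} s → (+ (s %ℕ N)) ≡[ N ] s
≡[]-%ℕ N s = ≡[]-by (+ (s %ℕ N)) s (-ᶻ (s /ℕ N)) (sym (begin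
  s +ᶻ -ᶻ (s /ℕ N) *ᶻ + N
    ≡⟨ cong (λ s′ → s′ +ᶻ -ᶻ (s /ℕ N) *ᶻ + N) (a≡a%ℕn+[a/ℕn]*n s N) ⟩
  + (s %ℕ N) +ᶻ s /ℕ N *ᶻ + N +ᶻ -ᶻ (s /ℕ N) *ᶻ + N
    ≡⟨ cancel (+ (s %ℕ N)) (s /ℕ N) (+ N) ⟩
  + (s %ℕ N) ∎))
  where
  open ≡-Reasoning
  cancel : ∀ r q n → r +ᶻ q *ᶻ n +ᶻ -ᶻ q *ᶻ n ≡ r
  cancel = solve-∀

∑-𝟙-residue : ∀ N .{{_ : NonZero N}} s → ∑[ c < N ] 𝟙 ((+ c) ≡[ N ]? s) ≡ 1
∑-𝟙-residue N s =
  trans (∑-cong< N (λ c c<N → 𝟙-cong (canonical c<N) reduce ((+ c) ≡[ N ]? s) (c ≟ r))) (∑-𝟙-≟ N r r<N)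
  where
  r : ℕ
  r = s %ℕ N
  r<N : r < N
  r<N = n%ℕd<d s N
  canonical : ∀ {c} → c < N → (+ c) ≡[ N ] s → c ≡ r
  canonical {c} c<N c≡s =
    ≡[]-canonical c<N r<N (≡[]-trans (+ c) s (+ r) c≡s (≡[]-sym (+ r) s (≡[]-%ℕ N s)))
  reduce : ∀ {c} → c ≡ r → (+ c) ≡[ N ] s
  reduce refl = ≡[]-%ℕ N s

≡[]-unit-cancel : ∀ {N} a b c t → (a *ᶻ b) ≡[ N ] (+ 1) → (a *ᶻ c) ≡[ N ] t → c ≡[ N ] (b *ᶻ t)
≡[]-unit-cancel a b c t ab≡1 ac≡t = ∣⇒≡[] c (b *ᶻ t)
  (b ∣* ≡[]⇒∣ (a *ᶻ c) t ac≡t ∣+ -ᶻ c ∣* ≡[]⇒∣ (a *ᶻ b) (+ 1) ab≡1)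
  (solve (a List.∷ b List.∷ c List.∷ t List.∷ List.[]))

≡[]-unit-solve : ∀ {N} a b c t → (a *ᶻ b) ≡[ N ] (+ 1) → c ≡[ N ] (b *ᶻ t) → (a *ᶻ c) ≡[ N ] t
≡[]-unit-solve a b c t ab≡1 c≡bt = ∣⇒≡[] (a *ᶻ c) t
  (a ∣* ≡[]⇒∣ c (b *ᶻ t) c≡bt ∣+ t ∣* ≡[]⇒∣ (a *ᶻ b) (+ 1) ab≡1)
  (solve (a List.∷ b List.∷ c List.∷ t List.∷ List.[]))

≡[]-divisor : ∀ {N} d a c t → d ∣ a → d ∣ + N → (a *ᶻ c) ≡[ N ] t → d ∣ t
≡[]-divisor d a c t d∣a d∣N ac≡t =
  ∣-≡ (c ∣* d∣a ∣+ -ᶻ + 1 ∣* ∣-trans d∣N (≡[]⇒∣ (a *ᶻ c) t ac≡t))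
      (solve (a List.∷ c List.∷ t List.∷ List.[]))

∣-scale∣ : ∀ d x y → ℤ.∣ + d *ᶻ x -ᶻ + d *ᶻ y ∣ ≡ d * ℤ.∣ x -ᶻ y ∣
∣-scale∣ d x y = trans (cong ℤ.∣_∣ (factor (+ d) x y)) (ℤ.abs-* (+ d) (x -ᶻ y))
  where
  factor : ∀ d x y → d *ᶻ x -ᶻ d *ᶻ y ≡ d *ᶻ (x -ᶻ y)
  factor = solve-∀

≡[]-*-cancelˡ : ∀ d {N} .{{_ : NonZero d}} x y → (+ d *ᶻ x) ≡[ d * N ] (+ d *ᶻ y) → x ≡[ N ] y
≡[]-*-cancelˡ d {N} x y dx≡dy = ℕ.*-cancelˡ-∣ d (subst ((d * N) ℕ.∣_) (∣-scale∣ d x y) dx≡dy)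

≡[]-*-monoˡ : ∀ d {N} x y → x ≡[ N ] y → (+ d *ᶻ x) ≡[ d * N ] (+ d *ᶻ y)
≡[]-*-monoˡ d {N} x y x≡y = subst ((d * N) ℕ.∣_) (sym (∣-scale∣ d x y)) (ℕ.*-monoʳ-∣ d x≡y)

coprime-prime : ∀ {p a} → Prime p → ¬ p ℕ.∣ a → Coprime a p
coprime-prime pp p∤a {d} (d∣a , d∣p) with prime⇒irreducible pp d∣p
... | inj₁ d≡1  = d≡1
... | inj₂ refl = ⊥-elim (p∤a d∣a)

coprime-* : ∀ {a b c} → Coprime a b → Coprime a c → Coprime a (b * c)
coprime-* {b = b} a⊥b a⊥c {d} (d∣a , d∣bc) = a⊥c (d∣a , coprime-divisor d⊥b d∣bc)
  where
  d⊥b : Coprime d b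
  d⊥b (e∣d , e∣b) = a⊥b (ℕ.∣-trans e∣d d∣a , e∣b)

coprime-prime-^ : ∀ {p a} → Prime p → ¬ p ℕ.∣ a → ∀ m → Coprime a (p ^ m)
coprime-prime-^ pp p∤a zero    (_ , d∣1) = ℕ.∣1⇒≡1 d∣1
coprime-prime-^ pp p∤a (suc m) = coprime-* (coprime-prime pp p∤a) (coprime-prime-^ pp p∤a m)

pos-+-* : ∀ c x a → + (c + x * a) ≡ + c +ᶻ + x *ᶻ + a
pos-+-* c x a = trans (ℤ.pos-+ c (x * a)) (cong ((+ c) +ᶻ_) (ℤ.pos-* x a))

coprime⇒invertible : ∀ {a N} → Coprime a N → ∃ λ b → (+ a *ᶻ b) ≡[ N ] (+ 1)
coprime⇒invertible {a} {N} a⊥N with coprime-Bézout a⊥N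
... | Bézout.+- x y 1+yN≡xa = + x , ≡[]-by (+ a *ᶻ + x) (+ 1) (+ y) (begin
  + a *ᶻ + x           ≡⟨ ℤ.*-comm (+ a) (+ x) ⟩
  + x *ᶻ + a           ≡⟨ ℤ.pos-* x a ⟨
  + (x * a)            ≡⟨ cong +_ 1+yN≡xa ⟨
  + (1 + y * N)        ≡⟨ pos-+-* 1 y N ⟩
  + 1 +ᶻ + y *ᶻ + N    ∎)
  where open ≡-Reasoning
... | Bézout.-+ x y 1+xa≡yN = -ᶻ + x , ≡[]-by (+ a *ᶻ -ᶻ + x) (+ 1) (-ᶻ + y) (begin
  + a *ᶻ -ᶻ + x               ≡⟨ negate (+ a) (+ x) ⟩
  + 1 -ᶻ (+ 1 +ᶻ + x *ᶻ + a)  ≡⟨ cong (_-ᶻ_ (+ 1)) (pos-+-* 1 x a) ⟨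
  + 1 -ᶻ + (1 + x * a)        ≡⟨ cong (λ n → + 1 -ᶻ + n) 1+xa≡yN ⟩
  + 1 -ᶻ + (y * N)            ≡⟨ cong (_-ᶻ_ (+ 1)) (ℤ.pos-* y N) ⟩
  + 1 -ᶻ + y *ᶻ + N           ≡⟨ tidy (+ y) (+ N) ⟩
  + 1 +ᶻ -ᶻ + y *ᶻ + N        ∎)
  where
  open ≡-Reasoning
  negate : ∀ a x → a *ᶻ -ᶻ x ≡ + 1 -ᶻ (+ 1 +ᶻ x *ᶻ a)
  negate = solve-∀
  tidy : ∀ y n → + 1 -ᶻ y *ᶻ n ≡ + 1 +ᶻ -ᶻ y *ᶻ n
  tidy = solve-∀

-- Counting solutions of a c ≡ t

𝟙[_·_≡_mod_] : ℕ → ℕ → ℤ → ℕ → ℕ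
𝟙[ a · c ≡ t mod N ] = 𝟙 ((+ a *ᶻ + c) ≡[ N ]? t)

linearCount : ℕ → ℕ → ℤ → ℕ
linearCount N a t = ∑[ c < N ] 𝟙[ a · c ≡ t mod N ]

productCount : ℕ → ℤ → ℕ
productCount N t = ∑[ a < N ] linearCount N a t

𝟙[·≡]-periodicʳ : ∀ N a c t → 𝟙[ a · (N + c) ≡ t mod N ] ≡ 𝟙[ a · c ≡ t mod N ]
𝟙[·≡]-periodicʳ N a c t = 𝟙-≡[]-respˡ (+ a *ᶻ + (N + c)) (+ a *ᶻ + c) t
  (≡[]-by _ _ (+ a) (trans (cong (+ a *ᶻ_) (ℤ.pos-+ N c)) (expand (+ a) (+ N) (+ c))))
  where
  expand : ∀ a n c → a *ᶻ (n +ᶻ c) ≡ a *ᶻ c +ᶻ a *ᶻ n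
  expand = solve-∀

𝟙[·≡]-periodicˡ : ∀ N a c t → 𝟙[ (N + a) · c ≡ t mod N ] ≡ 𝟙[ a · c ≡ t mod N ]
𝟙[·≡]-periodicˡ N a c t = 𝟙-≡[]-respˡ (+ (N + a) *ᶻ + c) (+ a *ᶻ + c) t
  (≡[]-by _ _ (+ c) (trans (cong (_*ᶻ + c) (ℤ.pos-+ N a)) (expand (+ a) (+ N) (+ c))))
  where
  expand : ∀ a n c → (n +ᶻ a) *ᶻ c ≡ a *ᶻ c +ᶻ c *ᶻ n
  expand = solve-∀

linearCount-invertible : ∀ N .{{_ : NonZero N}} a t → (∃ λ b → (+ a *ᶻ b) ≡[ N ] (+ 1)) →
                         linearCount N a t ≡ 1
linearCount-invertible N a t (b , ab≡1) = trans (∑-cong N unique-solution) (∑-𝟙-residue N (b *ᶻ t))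
  where
  unique-solution : ∀ c → 𝟙[ a · c ≡ t mod N ] ≡ 𝟙 ((+ c) ≡[ N ]? (b *ᶻ t))
  unique-solution c = 𝟙-cong (≡[]-unit-cancel (+ a) b (+ c) t ab≡1) (≡[]-unit-solve (+ a) b (+ c) t ab≡1)
                             ((+ a *ᶻ + c) ≡[ N ]? t) ((+ c) ≡[ N ]? (b *ᶻ t))

linearCount-divisor : ∀ N d a t → d ℕ.∣ a → d ℕ.∣ N → ¬ (+ d ∣ t) → linearCount N a t ≡ 0
linearCount-divisor N d a t d∣a d∣N d∤t = trans (∑-cong N no-solution) (∑-zero N)
  where
  no-solution : ∀ c → 𝟙[ a · c ≡ t mod N ] ≡ 0
  no-solution c = 𝟙-reject (d∤t ∘ ≡[]-divisor (+ d) (+ a) (+ c) t (∣ᵤ⇒∣ d∣a) (∣ᵤ⇒∣ d∣N))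
                           ((+ a *ᶻ + c) ≡[ N ]? t)

linearCount-scale : ∀ d N .{{_ : NonZero d}} a t →
                    linearCount (d * N) (d * a) (+ d *ᶻ t) ≡ d * linearCount N a t
linearCount-scale d N a t = trans (∑-cong (d * N) cancel-d)
  (∑-periodic d N (λ c → 𝟙[ a · c ≡ t mod N ]) (λ c → 𝟙[·≡]-periodicʳ N a c t))
  where
  ≡dt : ℤ → Set
  ≡dt z = z ≡[ d * N ] (+ d *ᶻ t)
  reassoc : ∀ c → + (d * a) *ᶻ + c ≡ + d *ᶻ (+ a *ᶻ + c)
  reassoc c = trans (cong (_*ᶻ + c) (ℤ.pos-* d a)) (ℤ.*-assoc (+ d) (+ a) (+ c))
  cancel-d : ∀ c → 𝟙[ d * a · c ≡ + d *ᶻ t mod d * N ] ≡ 𝟙[ a · c ≡ t mod N ]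
  cancel-d c = 𝟙-cong
    (≡[]-*-cancelˡ d (+ a *ᶻ + c) t ∘ subst ≡dt (reassoc c))
    (subst ≡dt (sym (reassoc c)) ∘ ≡[]-*-monoˡ d (+ a *ᶻ + c) t)
    ((+ (d * a) *ᶻ + c) ≡[ d * N ]? (+ d *ᶻ t)) ((+ a *ᶻ + c) ≡[ N ]? t)

-- Counting modulo prime powers

productCount-split : ∀ p m t → Prime p → productCount (p * p ^ m) t ≡
                     ∑[ i < p ^ m ] linearCount (p * p ^ m) (i * p) t + p ^ m * (p ∸ 1)
productCount-split p@(suc q) m t pp = begin
  ∑< (p * M) (λ a → linearCount N a t)
    ≡⟨ cong (λ n → ∑< n (λ a → linearCount N a t)) (*-comm p M) ⟩
  ∑< (M * p) (λ a → linearCount N a t)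
    ≡⟨ ∑-residues M p (λ a → linearCount N a t) ⟩
  ∑[ i < M ] (linearCount N (i * p + 0) t + ∑[ r < q ] linearCount N (i * p + suc r) t)
    ≡⟨ ∑-cong M (λ i → cong₂ _+_ (cong (λ a → linearCount N a t) (+-identityʳ (i * p)))
                                 (trans (∑-cong< q (unit i)) (∑-const q 1))) ⟩
  ∑[ i < M ] (linearCount N (i * p) t + q * 1)
    ≡⟨ ∑-distrib-+ M _ _ ⟩
  ∑[ i < M ] linearCount N (i * p) t + ∑[ _ < M ] (q * 1)
    ≡⟨ cong (_+_ (∑[ i < M ] linearCount N (i * p) t))
            (trans (∑-const M (q * 1)) (cong (M *_) (*-identityʳ q))) ⟩
  ∑[ i < M ] linearCount N (i * p) t + M * q ∎
  where
  open ≡-Reasoning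
  M : ℕ
  M = p ^ m
  N : ℕ
  N = p * M
  instance
    N≢0 : NonZero N
    N≢0 = m^n≢0 p (suc m)
  unit : ∀ i r → r < q → linearCount N (i * p + suc r) t ≡ 1
  unit i r r<q =
    linearCount-invertible N (i * p + suc r) t (coprime⇒invertible (coprime-prime-^ pp p∤a (suc m)))
    where
    p∤a : ¬ p ℕ.∣ i * p + suc r
    p∤a p∣a = ℕ.>⇒∤ (s<s r<q) (ℕ.∣m+n∣m⇒∣n p∣a (ℕ.n∣m*n i))

productCount-nondivisible : ∀ p m t → Prime p → ¬ (+ p ∣ t) →
                            productCount (p * p ^ m) t ≡ p ^ m * (p ∸ 1)
productCount-nondivisible p m t pp p∤t = trans (productCount-split p m t pp)
  (cong (_+ p ^ m * (p ∸ 1)) (trans (∑-cong (p ^ m) no-solution) (∑-zero (p ^ m))))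
  where
  no-solution : ∀ i → linearCount (p * p ^ m) (i * p) t ≡ 0
  no-solution i = linearCount-divisor (p * p ^ m) p (i * p) t (ℕ.n∣m*n i) (ℕ.m∣m*n (p ^ m)) p∤t

productCount-scale : ∀ p m t → Prime p →
  productCount (p * p ^ m) (+ p *ᶻ t) ≡ p * productCount (p ^ m) t + p ^ m * (p ∸ 1)
productCount-scale p m t pp = trans (productCount-split p m (+ p *ᶻ t) pp)
  (cong (_+ p ^ m * (p ∸ 1))
        (trans (∑-cong (p ^ m) scale) (∑-distribˡ-* (p ^ m) p (λ i → linearCount (p ^ m) i t))))
  where
  instance
    p≢0 : NonZero p
    p≢0 = prime⇒nonZero pp
  scale : ∀ i → linearCount (p * p ^ m) (i * p) (+ p *ᶻ t) ≡ p * linearCount (p ^ m) i t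
  scale i = trans (cong (λ a → linearCount (p * p ^ m) a (+ p *ᶻ t)) (*-comm i p))
                  (linearCount-scale p (p ^ m) i t)

productCount-scale-nondivisible : ∀ p m t → Prime p → ¬ (+ p ∣ t) →
  productCount (p * p ^ suc m) (+ p *ᶻ t) ≡ 2 * (p ^ suc m * (p ∸ 1))
productCount-scale-nondivisible p m t pp p∤t = begin
  productCount (p * p ^ suc m) (+ p *ᶻ t)
    ≡⟨ productCount-scale p (suc m) t pp ⟩
  p * productCount (p * p ^ m) t + p ^ suc m * (p ∸ 1)
    ≡⟨ cong (λ x → p * x + p ^ suc m * (p ∸ 1)) (productCount-nondivisible p m t pp p∤t) ⟩
  p * (p ^ m * (p ∸ 1)) + p * p ^ m * (p ∸ 1)
    ≡⟨ double p (p ^ m) (p ∸ 1) ⟩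
  2 * (p * p ^ m * (p ∸ 1)) ∎
  where
  open ≡-Reasoning
  double : ∀ p X q → p * (X * q) + p * X * q ≡ 2 * (p * X * q)
  double = ℕ-Solver.solve-∀

productCount-zero : ∀ p m → Prime p → p * productCount (p ^ m) (+ 0) ≡ p ^ m * (p + m * (p ∸ 1))
productCount-zero p zero    pp = trans (*-identityʳ p) (sym (trans (*-identityˡ _) (+-identityʳ p)))
productCount-zero p (suc m) pp = begin
  p * productCount (p * p ^ m) (+ 0)
    ≡⟨ cong (λ t → p * productCount (p * p ^ m) t) (ℤ.*-zeroʳ (+ p)) ⟨
  p * productCount (p * p ^ m) (+ p *ᶻ + 0)
    ≡⟨ cong (p *_) (productCount-scale p m (+ 0) pp) ⟩
  p * (p * productCount (p ^ m) (+ 0) + p ^ m * (p ∸ 1))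
    ≡⟨ cong (λ x → p * (x + p ^ m * (p ∸ 1))) (productCount-zero p m pp) ⟩
  p * (p ^ m * (p + m * (p ∸ 1)) + p ^ m * (p ∸ 1))
    ≡⟨ collect p (p ^ m) m (p ∸ 1) ⟩
  p * p ^ m * (p + suc m * (p ∸ 1)) ∎
  where
  open ≡-Reasoning
  collect : ∀ p X m q → p * (X * (p + m * q) + X * q) ≡ p * X * (p + suc m * q)
  collect = ℕ-Solver.solve-∀

∑-𝟙-lifts : ∀ p M .{{_ : NonZero p}} .{{_ : NonZero M}} x →
  ∑[ j < p ] 𝟙 (x ≡[ p * M ]? (-ᶻ + (j * M))) ≡ 𝟙 (x ≡[ M ]? (+ 0))
∑-𝟙-lifts p M x with x ≡[ M ]? (+ 0)
... | yes x≡0 = lifts-of-multiple (≡[]⇒∣ x (+ 0) x≡0)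
  where
  lifts-of-multiple : + M ∣ x -ᶻ + 0 → ∑[ j < p ] 𝟙 (x ≡[ p * M ]? (-ᶻ + (j * M))) ≡ 1
  lifts-of-multiple (divides q x-0≡qM) =
    trans (∑-cong p (λ j → 𝟙-cong (lift⇒j j) (j⇒lift j) _ ((+ j) ≡[ p ]? (-ᶻ q)))) (∑-𝟙-residue p (-ᶻ q))
    where
    factor : ∀ j → ℤ.∣ x -ᶻ -ᶻ + (j * M) ∣ ≡ ℤ.∣ + j -ᶻ -ᶻ q ∣ * M
    factor j = trans (cong ℤ.∣_∣ (begin
      x -ᶻ -ᶻ + (j * M)
        ≡⟨ cong₂ (λ a b → a -ᶻ -ᶻ b) (trans (sym (ℤ.+-identityʳ x)) x-0≡qM) (ℤ.pos-* j M) ⟩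
      q *ᶻ + M -ᶻ -ᶻ (+ j *ᶻ + M)
        ≡⟨ collect q (+ j) (+ M) ⟩
      (+ j -ᶻ -ᶻ q) *ᶻ + M ∎)) (ℤ.abs-* (+ j -ᶻ -ᶻ q) (+ M))
      where
      open ≡-Reasoning
      collect : ∀ q j m → q *ᶻ m -ᶻ -ᶻ (j *ᶻ m) ≡ (j -ᶻ -ᶻ q) *ᶻ m
      collect = solve-∀
    lift⇒j : ∀ j → x ≡[ p * M ] (-ᶻ + (j * M)) → (+ j) ≡[ p ] (-ᶻ q)
    lift⇒j j h = ℕ.*-cancelʳ-∣ M (subst ((p * M) ℕ.∣_) (factor j) h)
    j⇒lift : ∀ j → (+ j) ≡[ p ] (-ᶻ q) → x ≡[ p * M ] (-ᶻ + (j * M))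
    j⇒lift j h = subst ((p * M) ℕ.∣_) (sym (factor j)) (ℕ.*-monoˡ-∣ M h)
... | no x≢0 =
  trans (∑-cong p (λ j → 𝟙-reject (x≢0 ∘ lift⇒0 j) (x ≡[ p * M ]? (-ᶻ + (j * M))))) (∑-zero p)
  where
  lift⇒0 : ∀ j → x ≡[ p * M ] (-ᶻ + (j * M)) → x ≡[ M ] (+ 0)
  lift⇒0 j h = ∣⇒≡[] x (+ 0)
    (∣-trans (∣ᵤ⇒∣ (ℕ.n∣m*n p)) (≡[]⇒∣ x (-ᶻ + (j * M)) h) ∣+ -ᶻ + 1 ∣* ∣ᵤ⇒∣ (ℕ.n∣m*n j))
    (drop-multiple x (+ (j * M)))
    where
    drop-multiple : ∀ x k → x -ᶻ + 0 ≡ x -ᶻ -ᶻ k +ᶻ -ᶻ + 1 *ᶻ k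
    drop-multiple = solve-∀

∑-productCount-lifts : ∀ p M .{{_ : NonZero p}} .{{_ : NonZero M}} →
  ∑[ j < p ] productCount (p * M) (-ᶻ + (j * M)) ≡ p * (p * productCount M (+ 0))
∑-productCount-lifts p M = begin
  ∑[ j < p ] ∑[ a < N ] ∑[ c < N ] F j a c
    ≡⟨ ∑-swap p N (λ j a → ∑[ c < N ] F j a c) ⟩
  ∑[ a < N ] ∑[ j < p ] ∑[ c < N ] F j a c
    ≡⟨ ∑-cong N (λ a → ∑-swap p N (λ j c → F j a c)) ⟩
  ∑[ a < N ] ∑[ c < N ] ∑[ j < p ] F j a c
    ≡⟨ ∑-cong N (λ a → ∑-cong N (λ c → ∑-𝟙-lifts p M (+ a *ᶻ + c))) ⟩
  ∑[ a < N ] ∑[ c < N ] 𝟙[ a · c ≡ + 0 mod M ]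
    ≡⟨ ∑-cong N (λ a → ∑-periodic p M _ (λ c → 𝟙[·≡]-periodicʳ M a c (+ 0))) ⟩
  ∑[ a < N ] (p * linearCount M a (+ 0))
    ≡⟨ ∑-distribˡ-* N p (λ a → linearCount M a (+ 0)) ⟩
  p * ∑[ a < N ] linearCount M a (+ 0)
    ≡⟨ cong (p *_) (∑-periodic p M _ (λ a → ∑-cong M (λ c → 𝟙[·≡]-periodicˡ M a c (+ 0)))) ⟩
  p * (p * productCount M (+ 0)) ∎
  where
  open ≡-Reasoning
  N : ℕ
  N = p * M
  F : ℕ → ℕ → ℕ → ℕ
  F j a c = 𝟙 ((+ a *ᶻ + c) ≡[ N ]? (-ᶻ + (j * M)))

R2≡productCount : ∀ N b → R2 N b ≡ productCount N (b +ᶻ + 1)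
R2≡productCount N b = trans (count-allVec 2 N _ g (λ { (_ ∷ _ ∷ []) → refl }))
  (∑-cong N (λ a → ∑-cong N (λ c → 𝟙-cong (shift (+ a *ᶻ + c)) (unshift (+ a *ᶻ + c)) _ _)))
  where
  g : Vec ℕ 2 → ℕ
  g (a ∷ c ∷ []) = 𝟙 ((+ a *ᶻ + c -ᶻ + 1) ≡[ N ]? b)
  regroup : ∀ z b → z -ᶻ + 1 -ᶻ b ≡ z -ᶻ (b +ᶻ + 1)
  regroup = solve-∀
  shift : ∀ z → (z -ᶻ + 1) ≡[ N ] b → z ≡[ N ] (b +ᶻ + 1)
  shift z = subst (N ℕ.∣_) (cong ℤ.∣_∣ (regroup z b))
  unshift : ∀ z → z ≡[ N ] (b +ᶻ + 1) → (z -ᶻ + 1) ≡[ N ] b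
  unshift z = subst (N ℕ.∣_) (cong ℤ.∣_∣ (sym (regroup z b)))

R2-nondivisible : ∀ p m b → Prime p → ¬ (+ p ∣ b +ᶻ + 1) → R2 (p * p ^ m) b ≡ p ^ m * (p ∸ 1)
R2-nondivisible p m b pp p∤b+1 =
  trans (R2≡productCount (p * p ^ m) b) (productCount-nondivisible p m (b +ᶻ + 1) pp p∤b+1)

∑-R2-lifts : ∀ p m → Prime p →
  sum (map (λ j → R2 (p ^ suc m) (-ᶻ + (1 + j * p ^ m))) (upTo p)) ≡ p ^ suc m * (suc m * (p ∸ 1) + 1)
∑-R2-lifts p m pp = begin
  sum (map (λ j → R2 N (-ᶻ + (1 + j * X))) (upTo p))
    ≡⟨ sum-map-applyUpTo p _ id ⟩
  ∑[ j < p ] R2 N (-ᶻ + (1 + j * X))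
    ≡⟨ ∑-cong p (λ j → trans (R2≡productCount N _) (cong (productCount N) (cancel-1 (j * X)))) ⟩
  ∑[ j < p ] productCount N (-ᶻ + (j * X))
    ≡⟨ ∑-productCount-lifts p X ⟩
  p * (p * productCount X (+ 0))
    ≡⟨ cong (p *_) (productCount-zero p m pp) ⟩
  p * (X * (p + m * (p ∸ 1)))
    ≡⟨ regroup p X m ⟩
  N * (suc m * (p ∸ 1) + 1) ∎
  where
  open ≡-Reasoning
  X : ℕ
  X = p ^ m
  N : ℕ
  N = p * X
  instance
    p≢0 : NonZero p
    p≢0 = prime⇒nonZero pp
    X≢0 : NonZero X
    X≢0 = m^n≢0 p m
  cancel-1 : ∀ n → -ᶻ + (1 + n) +ᶻ + 1 ≡ -ᶻ + n
  cancel-1 n = trans (cong (λ z → -ᶻ z +ᶻ + 1) (ℤ.pos-+ 1 n)) (cancel (+ n))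
    where
    cancel : ∀ x → -ᶻ (+ 1 +ᶻ x) +ᶻ + 1 ≡ -ᶻ x
    cancel = solve-∀
  regroup : ∀ p X m → p * (X * (p + m * (p ∸ 1))) ≡ p * X * (suc m * (p ∸ 1) + 1)
  regroup zero    X m = refl
  regroup (suc q) X m = ring q X m
    where
    ring : ∀ q X m → (1 + q) * (X * ((1 + q) + m * q)) ≡ (1 + q) * X * ((1 + m) * q + 1)
    ring = ℕ-Solver.solve-∀

R2[-1]-closed : ∀ p m → Prime p → R2 (p ^ suc m) (-ᶻ + 1) ≡ p ^ m * (p * (suc m + 1) ∸ suc m)
R2[-1]-closed p m pp = *-cancelˡ-≡ _ _ p (begin
  p * R2 (p * X) (-ᶻ + 1)               ≡⟨ cong (p *_) (R2≡productCount (p * X) (-ᶻ + 1)) ⟩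
  p * productCount (p * X) (+ 0)        ≡⟨ productCount-zero p (suc m) pp ⟩
  p * X * (p + suc m * (p ∸ 1))         ≡⟨ regroup p X (suc m) ⟩
  p * (X * (p * (suc m + 1) ∸ suc m))   ∎)
  where
  open ≡-Reasoning
  X : ℕ
  X = p ^ m
  instance
    p≢0 : NonZero p
    p≢0 = prime⇒nonZero pp
  regroup : ∀ p X m → p * X * (p + m * (p ∸ 1)) ≡ p * (X * (p * (m + 1) ∸ m))
  regroup zero    X m = refl
  regroup (suc q) X m = trans (ring₁ q X m)
    (cong (λ z → suc q * (X * z)) (sym (trans (cong (_∸ m) (ring₂ q m)) (m+n∸m≡n m (suc q + m * q)))))
    where
    ring₁ : ∀ q X m → (1 + q) * X * ((1 + q) + m * q) ≡ (1 + q) * (X * ((1 + q) + m * q))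
    ring₁ = ℕ-Solver.solve-∀
    ring₂ : ∀ q m → (1 + q) * (m + 1) ≡ m + ((1 + q) + m * q)
    ring₂ = ℕ-Solver.solve-∀

-- The matrix M₄

mat-cong : ∀ {a b c d a′ b′ c′ d′} → a ≡ a′ → b ≡ b′ → c ≡ c′ → d ≡ d′ →
           mat a b c d ≡ mat a′ b′ c′ d′
mat-cong refl refl refl refl = refl

Mn-∷ : ∀ {n} x (xs : Vec ℤ n) {a b c d} → Mn xs ≡ mat a b c d →
       Mn (x ∷ xs) ≡ mat (a *ᶻ x +ᶻ b) (-ᶻ a) (c *ᶻ x +ᶻ d) (-ᶻ c)
Mn-∷ x xs {a} {b} {c} {d} Mn-xs rewrite Mn-xs =
  mat-cong (cong (_+ᶻ_ (a *ᶻ x)) (ℤ.*-identityʳ b)) (negate a b)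
           (cong (_+ᶻ_ (c *ᶻ x)) (ℤ.*-identityʳ d)) (negate c d)
  where
  negate : ∀ a b → a *ᶻ -ᶻ + 1 +ᶻ b *ᶻ + 0 ≡ -ᶻ a
  negate = solve-∀

-- The ring solver sees the entries of _⊗_ only as opaque record projections, so the
-- product is first unfolded one factor at a time by Mn-∷.
Mn₄-formula : ∀ a₁ a₂ a₃ a₄ → Mn (a₁ ∷ a₂ ∷ a₃ ∷ a₄ ∷ []) ≡
  mat ((a₃ *ᶻ a₄ -ᶻ + 1) *ᶻ (a₁ *ᶻ a₂ -ᶻ + 1) -ᶻ a₄ *ᶻ a₁) (a₄ -ᶻ (a₃ *ᶻ a₄ -ᶻ + 1) *ᶻ a₂)
      (a₃ *ᶻ (a₁ *ᶻ a₂ -ᶻ + 1) -ᶻ a₁)                      (+ 1 -ᶻ a₃ *ᶻ a₂)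
Mn₄-formula a₁ a₂ a₃ a₄ =
  trans (Mn-∷ a₁ (a₂ ∷ a₃ ∷ a₄ ∷ []) (Mn-∷ a₂ (a₃ ∷ a₄ ∷ []) (Mn-∷ a₃ (a₄ ∷ []) (Mn-∷ a₄ [] refl))))
        (mat-cong (solve as) (solve as) (solve as) (solve as))
  where
  as : List ℤ
  as = a₁ List.∷ a₂ List.∷ a₃ List.∷ a₄ List.∷ List.[]

M₄≡uI : ℕ → ℤ → ℤ → ℤ → ℤ → ℤ → Set
M₄≡uI N u a₁ a₂ a₃ a₄ =
    + N ∣ (a₃ *ᶻ a₄ -ᶻ + 1) *ᶻ (a₁ *ᶻ a₂ -ᶻ + 1) -ᶻ a₄ *ᶻ a₁ -ᶻ u
  × + N ∣ a₄ -ᶻ (a₃ *ᶻ a₄ -ᶻ + 1) *ᶻ a₂ -ᶻ + 0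
  × + N ∣ a₃ *ᶻ (a₁ *ᶻ a₂ -ᶻ + 1) -ᶻ a₁ -ᶻ + 0
  × + N ∣ + 1 -ᶻ a₃ *ᶻ a₂ -ᶻ u

M₄≡uI-parametrised : ℕ → ℤ → ℤ → ℤ → ℤ → ℤ → Set
M₄≡uI-parametrised N u a₁ a₂ a₃ a₄ =
  ((a₁ *ᶻ a₂) ≡[ N ] (-ᶻ u +ᶻ + 1) × a₃ ≡[ N ] (-ᶻ (u *ᶻ a₁))) × a₄ ≡[ N ] (-ᶻ (u *ᶻ a₂))

1-u²≡0 : ∀ {N} u → u *ᶻ u ≡ + 1 → + N ∣ + 1 -ᶻ u *ᶻ u
1-u²≡0 u u²≡1 = ∣-≡ (divides (+ 0) refl) (sym (trans (cong (_-ᶻ_ (+ 1)) u²≡1) (ℤ.+-inverseʳ (+ 1))))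

-- Each congruence is an explicit ℤ-linear combination of the hypotheses and of 1 − u² ≡ 0;
-- the solver checks the underlying polynomial identity.
M₄≡uI⇒parametrised : ∀ {N} u a₁ a₂ a₃ a₄ → u *ᶻ u ≡ + 1 →
  M₄≡uI N u a₁ a₂ a₃ a₄ → M₄≡uI-parametrised N u a₁ a₂ a₃ a₄
M₄≡uI⇒parametrised u a₁ a₂ a₃ a₄ u²≡1 (d₁₁ , d₁₂ , d₂₁ , d₂₂) =
  ( ∣⇒≡[] (a₁ *ᶻ a₂) (-ᶻ u +ᶻ + 1)
      (-ᶻ (a₁ *ᶻ a₂ -ᶻ + 1) *ᶻ u ∣* d₂₂ ∣+ -ᶻ u *ᶻ a₂ ∣* d₂₁ ∣+ (a₁ *ᶻ a₂ -ᶻ + 1) ∣* 1-u²≡0 u u²≡1)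
      (solve vs)
  , ∣⇒≡[] a₃ (-ᶻ (u *ᶻ a₁)) (-ᶻ + 1 ∣* d₂₁ ∣+ -ᶻ a₁ ∣* d₂₂) (solve vs) )
  , ∣⇒≡[] a₄ (-ᶻ (u *ᶻ a₂)) (-ᶻ a₂ ∣* d₁₁ ∣+ -ᶻ (a₁ *ᶻ a₂ -ᶻ + 1) ∣* d₁₂) (solve vs)
  where
  vs : List ℤ
  vs = a₁ List.∷ a₂ List.∷ a₃ List.∷ a₄ List.∷ u List.∷ List.[]

parametrised⇒M₄≡uI : ∀ {N} u a₁ a₂ a₃ a₄ → u *ᶻ u ≡ + 1 →
  M₄≡uI-parametrised N u a₁ a₂ a₃ a₄ → M₄≡uI N u a₁ a₂ a₃ a₄
parametrised⇒M₄≡uI {N} u a₁ a₂ a₃ a₄ u²≡1 ((a₁a₂≡1-u , a₃≡-ua₁) , a₄≡-ua₂) =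
    ∣-≡ (a₄ *ᶻ (a₁ *ᶻ a₂ -ᶻ + 1) ∣* d₃ ∣+ (-ᶻ (u *ᶻ a₁ *ᶻ a₄) -ᶻ + 1) ∣* d₁ ∣+ -ᶻ (a₁ *ᶻ a₄) ∣* d₀)
        (solve vs)
  , ∣-≡ (-ᶻ (a₂ *ᶻ a₄) ∣* d₃ ∣+ u *ᶻ a₄ ∣* d₁ ∣+ u ∣* d₄ ∣+ (a₄ +ᶻ a₂) ∣* d₀) (solve vs)
  , ∣-≡ ((a₁ *ᶻ a₂ -ᶻ + 1) ∣* d₃ ∣+ -ᶻ u *ᶻ a₁ ∣* d₁ ∣+ -ᶻ a₁ ∣* d₀) (solve vs)
  , ∣-≡ (-ᶻ a₂ ∣* d₃ ∣+ u ∣* d₁ ∣+ + 1 ∣* d₀) (solve vs)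
  where
  vs : List ℤ
  vs = a₁ List.∷ a₂ List.∷ a₃ List.∷ a₄ List.∷ u List.∷ List.[]
  d₁ : + N ∣ a₁ *ᶻ a₂ -ᶻ (-ᶻ u +ᶻ + 1)
  d₁ = ≡[]⇒∣ (a₁ *ᶻ a₂) (-ᶻ u +ᶻ + 1) a₁a₂≡1-u
  d₃ : + N ∣ a₃ -ᶻ -ᶻ (u *ᶻ a₁)
  d₃ = ≡[]⇒∣ a₃ (-ᶻ (u *ᶻ a₁)) a₃≡-ua₁
  d₄ : + N ∣ a₄ -ᶻ -ᶻ (u *ᶻ a₂)
  d₄ = ≡[]⇒∣ a₄ (-ᶻ (u *ᶻ a₂)) a₄≡-ua₂
  d₀ : + N ∣ + 1 -ᶻ u *ᶻ u
  d₀ = 1-u²≡0 u u²≡1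

Mn₄≡uI⇔parametrised : ∀ N u a₁ a₂ a₃ a₄ → u *ᶻ u ≡ + 1 →
  (Mn (a₁ ∷ a₂ ∷ a₃ ∷ a₄ ∷ []) ≡M[ N ] mat u (+ 0) (+ 0) u →
     M₄≡uI-parametrised N u a₁ a₂ a₃ a₄)
  × (M₄≡uI-parametrised N u a₁ a₂ a₃ a₄ →
     Mn (a₁ ∷ a₂ ∷ a₃ ∷ a₄ ∷ []) ≡M[ N ] mat u (+ 0) (+ 0) u)
Mn₄≡uI⇔parametrised N u a₁ a₂ a₃ a₄ u²≡1 =
    (λ h → case subst ≡uI (Mn₄-formula a₁ a₂ a₃ a₄) h of λ where
      (h₁₁ , h₁₂ , h₂₁ , h₂₂) →
        M₄≡uI⇒parametrised u a₁ a₂ a₃ a₄ u²≡1 (∣ᵤ⇒∣ h₁₁ , ∣ᵤ⇒∣ h₁₂ , ∣ᵤ⇒∣ h₂₁ , ∣ᵤ⇒∣ h₂₂))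
  , (λ h → case parametrised⇒M₄≡uI u a₁ a₂ a₃ a₄ u²≡1 h of λ where
      (d₁₁ , d₁₂ , d₂₁ , d₂₂) →
        subst ≡uI (sym (Mn₄-formula a₁ a₂ a₃ a₄)) (∣⇒∣ᵤ d₁₁ , ∣⇒∣ᵤ d₁₂ , ∣⇒∣ᵤ d₂₁ , ∣⇒∣ᵤ d₂₂))
  where
  ≡uI : Mat → Set
  ≡uI X = X ≡M[ N ] mat u (+ 0) (+ 0) u

w₄≡R2 : ∀ N .{{_ : NonZero N}} u → u *ᶻ u ≡ + 1 → w 4 N u u ≡ R2 N (-ᶻ u)
w₄≡R2 N u u²≡1 = begin
  w 4 N u u
    ≡⟨ count-allVec 4 N _ g (λ { (_ ∷ _ ∷ _ ∷ _ ∷ []) → refl }) ⟩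
  ∑[ a₁ < N ] ∑[ a₂ < N ] ∑[ a₃ < N ] ∑[ a₄ < N ] g (a₁ ∷ a₂ ∷ a₃ ∷ a₄ ∷ [])
    ≡⟨ ∑-cong N (λ a₁ → ∑-cong N (λ a₂ → ∑-cong N (λ a₃ → ∑-cong N (factorise a₁ a₂ a₃)))) ⟩
  ∑[ a₁ < N ] ∑[ a₂ < N ] ∑[ a₃ < N ] ∑[ a₄ < N ] (𝟙 (C a₁ a₂) * 𝟙 (A₃ a₁ a₃) * 𝟙 (A₄ a₂ a₄))
    ≡⟨ ∑-cong N (λ a₁ → ∑-cong N (λ a₂ → trans (∑-cong N (λ a₃ → sum-out _ (-ᶻ (u *ᶻ + a₂))))
                                                (sum-out _ (-ᶻ (u *ᶻ + a₁))))) ⟩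
  ∑[ a₁ < N ] ∑[ a₂ < N ] 𝟙 (C a₁ a₂)
    ≡⟨ R2≡productCount N (-ᶻ u) ⟨
  R2 N (-ᶻ u) ∎
  where
  open ≡-Reasoning
  g : Vec ℕ 4 → ℕ
  g (a₁ ∷ a₂ ∷ a₃ ∷ a₄ ∷ []) =
    𝟙 (Mn (+ a₁ ∷ + a₂ ∷ + a₃ ∷ + a₄ ∷ []) ≡M[ N ]? mat u (+ 0) (+ 0) u)
  C : ∀ a₁ a₂ → Dec ((+ a₁ *ᶻ + a₂) ≡[ N ] (-ᶻ u +ᶻ + 1))
  C a₁ a₂ = (+ a₁ *ᶻ + a₂) ≡[ N ]? (-ᶻ u +ᶻ + 1)
  A₃ : ∀ a₁ a₃ → Dec ((+ a₃) ≡[ N ] (-ᶻ (u *ᶻ + a₁)))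
  A₃ a₁ a₃ = (+ a₃) ≡[ N ]? (-ᶻ (u *ᶻ + a₁))
  A₄ : ∀ a₂ a₄ → Dec ((+ a₄) ≡[ N ] (-ᶻ (u *ᶻ + a₂)))
  A₄ a₂ a₄ = (+ a₄) ≡[ N ]? (-ᶻ (u *ᶻ + a₂))
  factorise : ∀ a₁ a₂ a₃ a₄ →
    g (a₁ ∷ a₂ ∷ a₃ ∷ a₄ ∷ []) ≡ 𝟙 (C a₁ a₂) * 𝟙 (A₃ a₁ a₃) * 𝟙 (A₄ a₂ a₄)
  factorise a₁ a₂ a₃ a₄ =
    let to , from = Mn₄≡uI⇔parametrised N u (+ a₁) (+ a₂) (+ a₃) (+ a₄) u²≡1 in
    trans (𝟙-cong to from _ ((C a₁ a₂ ×-dec A₃ a₁ a₃) ×-dec A₄ a₂ a₄))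
          (trans (𝟙-× _ (A₄ a₂ a₄)) (cong (_* 𝟙 (A₄ a₂ a₄)) (𝟙-× (C a₁ a₂) (A₃ a₁ a₃))))
  sum-out : ∀ k s → ∑[ c < N ] (k * 𝟙 ((+ c) ≡[ N ]? s)) ≡ k
  sum-out k s = trans (∑-distribˡ-* N k _) (trans (cong (k *_) (∑-𝟙-residue N s)) (*-identityʳ k))

prime∤2 : ∀ {p} → Prime p → p ≢ 2 → ¬ p ℕ.∣ 2
prime∤2 pp p≢2 p∣2 with prime⇒irreducible prime[2] p∣2
... | inj₁ refl = ¬prime[1] pp
... | inj₂ p≡2  = p≢2 p≡2

2∤1+2n : ∀ n → ¬ 2 ℕ.∣ 1 + 2 * n
2∤1+2n n 2∣1+2n with ℕ.∣1⇒≡1 (ℕ.∣m+n∣m⇒∣n (subst (2 ℕ.∣_) (+-comm 1 (2 * n)) 2∣1+2n) (ℕ.m∣m*n n))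
... | ()

counts-mod-2^m : ∀ m → 3 ≤ m →
  (w 4 (2 ^ m) (-ᶻ + 1) (-ᶻ + 1) ≡ R2 (2 ^ m) (+ 1))
  × (R2 (2 ^ m) (+ 1) ≡ R2 (2 ^ m) (+ (1 + 2 ^ (m ∸ 1))))
  × (R2 (2 ^ m) (+ 1) ≡ 2 ^ m)
counts-mod-2^m (suc (suc (suc m))) (s≤s (s≤s (s≤s z≤n))) =
  w₄≡R2 N (-ᶻ + 1) refl , trans R2[1] (sym R2[1+2Y]) , R2[1]
  where
  Y : ℕ
  Y = 2 ^ suc m
  N : ℕ
  N = 2 * (2 * Y)
  instance
    N≢0 : NonZero N
    N≢0 = m^n≢0 2 (3 + m)
  doubled-odd : ∀ n → productCount N (+ 2 *ᶻ + (1 + 2 * n)) ≡ N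
  doubled-odd n = trans
    (productCount-scale-nondivisible 2 (suc m) (+ (1 + 2 * n)) prime[2] (2∤1+2n n ∘ ∣⇒∣ᵤ))
    (cong (2 *_) (*-identityʳ (2 * Y)))
  R2[1] : R2 N (+ 1) ≡ N
  R2[1] = trans (R2≡productCount N (+ 1)) (doubled-odd 0)
  R2[1+2Y] : R2 N (+ (1 + 2 * Y)) ≡ N
  R2[1+2Y] = trans (R2≡productCount N _) (trans (cong (productCount N) halve) (doubled-odd (2 ^ m)))
    where
    ring : ∀ Y → 1 + 2 * Y + 1 ≡ 2 * (1 + Y)
    ring = ℕ-Solver.solve-∀
    halve : + (1 + 2 * Y) +ᶻ + 1 ≡ + 2 *ᶻ + (1 + Y)
    halve = trans (cong +_ (ring Y)) (ℤ.pos-* 2 (1 + Y))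

lemma4p2 : (m p k : ℕ) → 2 ≤ m → Prime p → k < p →
    ((p ≢ 2) →
      (w 4 (p ^ m) (ℤ.- + 1) (ℤ.- + 1) ≡ R2 (p ^ m) (+ (1 + k * p ^ (m ∸ 1))))
      × (R2 (p ^ m) (+ (1 + k * p ^ (m ∸ 1))) ≡ p ^ (m ∸ 1) * (p ∸ 1)))
    × ((sum (map (λ j → R2 (p ^ m) (ℤ.- + (1 + j * p ^ (m ∸ 1)))) (upTo p))
          ≡ p ^ m * (m * (p ∸ 1) + 1))
      × (w 4 (p ^ m) (+ 1) (+ 1) ≡ R2 (p ^ m) (ℤ.- + 1))
      × (R2 (p ^ m) (ℤ.- + 1) ≡ p ^ (m ∸ 1) * (p * (m + 1) ∸ m)))
    × (p ≡ 2 → 3 ≤ m →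
      (w 4 (2 ^ m) (ℤ.- + 1) (ℤ.- + 1) ≡ R2 (2 ^ m) (+ 1))
      × (R2 (2 ^ m) (+ 1) ≡ R2 (2 ^ m) (+ (1 + 2 ^ (m ∸ 1))))
      × (R2 (2 ^ m) (+ 1) ≡ 2 ^ m))
lemma4p2 (suc (suc m)) p k (s≤s (s≤s z≤n)) pp _ =
    (λ p≢2 → trans (w₄≡R2 N (-ᶻ + 1) refl) (trans (R2[1] p≢2) (sym (R2[1+kX] p≢2))) , R2[1+kX] p≢2)
  , (∑-R2-lifts p (suc m) pp , w₄≡R2 N (+ 1) refl , R2[-1]-closed p (suc m) pp)
  , (λ _ → counts-mod-2^m (suc (suc m)))
  where
  X : ℕ
  X = p ^ suc m
  N : ℕ
  N = p * X
  instance
    N≢0 : NonZero N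
    N≢0 = m^n≢0 p (suc (suc m)) {{prime⇒nonZero pp}}
  R2[1] : p ≢ 2 → R2 N (+ 1) ≡ X * (p ∸ 1)
  R2[1] p≢2 = R2-nondivisible p (suc m) (+ 1) pp (prime∤2 pp p≢2 ∘ ∣⇒∣ᵤ)
  R2[1+kX] : p ≢ 2 → R2 N (+ (1 + k * X)) ≡ X * (p ∸ 1)
  R2[1+kX] p≢2 = R2-nondivisible p (suc m) _ pp (prime∤2 pp p≢2 ∘ p∣2 ∘ ∣⇒∣ᵤ)
    where
    p∣2 : p ℕ.∣ 1 + k * X + 1 → p ℕ.∣ 2
    p∣2 p∣ = ℕ.∣m+n∣m⇒∣n (subst (p ℕ.∣_) (trans (+-comm (1 + k * X) 1) (+-comm 2 (k * X))) p∣)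
                        (ℕ.∣-trans (ℕ.m∣m*n (p ^ m)) (ℕ.n∣m*n k))
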